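{- Let $(X,Y,\phi)$ be an $L$-context and $X'\subseteq X$. The following are equivalent: (i) $X\setminus X'$ is $\phi$-reducible in RST; (ii) $\phi^\exists\mu=(\phi_{X',Y})^\exists(\phi^\forall\phi^\exists\mu)_{X'}$ for all $\mu\in L^X$; (iii) $\phi^\exists\phi^\forall=(\phi_{X',Y})^\exists(\phi_{X',Y})^\forall$ as maps $L^Y\to L^Y$; (iv) the map $\mathcal K(\tau,1_Y)\colon\mathcal K\phi_{X',Y}\to\mathcal K\phi$, $\mu'\mapsto\phi^\forall\phi^\exists\underline{\mu'}$, is surjective, and thus an isomorphism of complete $L$-lattices.
   Context: $L=(L,*)$ is a complete residuated lattice: a complete lattice with bottom $0$ and top $1$ with a commutative monoid operation $*$ with unit $1$ satisfying $a*\bigvee_i b_i=\bigvee_i a*b_i$; $\rightarrow$ is its residuum ($a*b\le c\iff a\le b\rightarrow c$). An $L$-context is $(X,Y,\phi)$ with $\phi\colon X\times Y\to L$. $L^X$ is the set of maps $X\to L$ with $L$-order $L^X(\mu,\mu')=\bigwedge_x\mu(x)\rightarrow\mu'(x)$. Define $\phi^\exists\colon L^X\to L^Y$, $\phi^\exists(\mu)(y)=\bigvee_x\mu(x)*\phi(x,y)$, $\phi^\forall\colon L^Y\to L^X$, $\phi^\forall(\lambda)(x)=\bigwedge_y\phi(x,y)\rightarrow\lambda(y)$, and $\mathcal K\phi=\{\mu\in L^X:\phi^\forall\phi^\exists\mu=\mu\}$ with the inherited $L$-order. $\phi_{X',Y}$ is the restriction of $\phi$ to $X'\times Y$ and $\tau\colon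 X'\to X$ the inclusion; $\mu_{X'}$ is the restriction of $\mu\in L^X$ to $X'$; for $\mu'\in L^{X'}$, $\underline{\mu'}\in L^X$ extends $\mu'$ by $0$ outside $X'$. $X\setminus X'$ is $\phi$-reducible in RST if for every $\mu\in L^X$ there is $\mu'\in L^{X'}$ with $\phi^\exists\mu=(\phi_{X',Y})^\exists\mu'$. An isomorphism of complete $L$-lattices is a bijection $h$ with $L^{X'}(p,p')=L^X(hp,hp')$ for all $p,p'$. -}

module Defs where

open import Level using (Level; _⊔_; suc)
open import Data.Product using (Σ; ∃; _×_; _,_; proj₁)
open import Relation.Binary.PropositionalEquality using (_≡_)
open import Relation.Binary.Structures using (IsPartialOrder)
open import Function.Bundles using (_⇔_)
open import Function.Definitions using (Injective)

-- A complete residuated lattice whose joins/meets range over index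
-- types in the universe Set ℓ (the universe where the sets X, Y live).
record CompleteResiduatedLattice (c ℓ : Level) : Set (suc (c ⊔ ℓ)) where
  infix  4 _≤_
  infixl 7 _*_
  infixr 5 _⇒_
  field
    Carrier   : Set c
    _≤_       : Carrier → Carrier → Set c
    isPartialOrder : IsPartialOrder _≡_ _≤_
    ⋁         : {I : Set ℓ} → (I → Carrier) → Carrier
    ⋁-upper   : {I : Set ℓ} (f : I → Carrier) (i : I) → f i ≤ ⋁ f
    ⋁-least   : {I : Set ℓ} (f : I → Carrier) (a : Carrier) → (∀ i → f i ≤ a) → ⋁ f ≤ a
    ⋀         : {I : Set ℓ} → (I → Carrier) → Carrier
    ⋀-lower   : {I : Set ℓ} (f : I → Carrier) (i : I) → ⋀ f ≤ f i
    ⋀-greatest : {I : Set ℓ} (f : I → Carrier) (a : Carrier) → (∀ i → a ≤ f i) → a ≤ ⋀ f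
    𝟘         : Carrier
    𝟙         : Carrier
    𝟘-bottom  : ∀ a → 𝟘 ≤ a
    𝟙-top     : ∀ a → a ≤ 𝟙
    _*_       : Carrier → Carrier → Carrier
    *-assoc   : ∀ a b c → (a * b) * c ≡ a * (b * c)
    *-comm    : ∀ a b → a * b ≡ b * a
    *-identityˡ : ∀ a → 𝟙 * a ≡ a
    *-distrib-⋁ : ∀ a {I : Set ℓ} (f : I → Carrier) → a * ⋁ f ≡ ⋁ (λ i → a * f i)
    _⇒_       : Carrier → Carrier → Carrier
    residuated : ∀ a b c → (a * b ≤ c) ⇔ (a ≤ b ⇒ c)

module Context {c ℓ : Level} (L : CompleteResiduatedLattice c ℓ) where
  open CompleteResiduatedLattice L

  subsethood : {X : Set ℓ} → (X → Carrier) → (X → Carrier) → Carrier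
  subsethood μ μ' = ⋀ (λ x → μ x ⇒ μ' x)

  up∃ : {X Y : Set ℓ} → (X → Y → Carrier) → (X → Carrier) → (Y → Carrier)
  up∃ φ μ y = ⋁ (λ x → μ x * φ x y)

  down∀ : {X Y : Set ℓ} → (X → Y → Carrier) → (Y → Carrier) → (X → Carrier)
  down∀ φ λ' x = ⋀ (λ y → φ x y ⇒ λ' y)

  InK : {X Y : Set ℓ} → (X → Y → Carrier) → (X → Carrier) → Set (c ⊔ ℓ)
  InK φ μ = ∀ x → down∀ φ (up∃ φ μ) x ≡ μ x

  -- restriction φ_{X',Y} along the inclusion τ : X' → X
  restrict : {X X' Y : Set ℓ} → (X' → X) → (X → Y → Carrier) → (X' → Y → Carrier)
  restrict τ φ x' y = φ (τ x') y

  -- extension by 0 outside X' (τ injective): \underline{μ'}(x) = ⋁_{x' ∈ τ⁻¹(x)} μ'(x')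
  extend : {X X' : Set ℓ} → (X' → X) → (X' → Carrier) → (X → Carrier)
  extend {X' = X'} τ μ' x = ⋁ {I = Σ X' (λ x' → τ x' ≡ x)} (λ p → μ' (proj₁ p))

  Reducible : {X X' Y : Set ℓ} → (X' → X) → (X → Y → Carrier) → Set (c ⊔ ℓ)
  Reducible {X' = X'} τ φ =
    ∀ μ → ∃ λ (μ' : X' → Carrier) → ∀ y → up∃ φ μ y ≡ up∃ (restrict τ φ) μ' y

  Kmap : {X X' Y : Set ℓ} → (X' → X) → (X → Y → Carrier) → (X' → Carrier) → (X → Carrier)
  Kmap τ φ μ' = down∀ φ (up∃ φ (extend τ μ'))

  KmapSurjective : {X X' Y : Set ℓ} → (X' → X) → (X → Y → Carrier) → Set (c ⊔ ℓ)
  KmapSurjective {X' = X'} τ φ =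
    ∀ ν → InK φ ν →
      ∃ λ (μ' : X' → Carrier) → InK (restrict τ φ) μ' × (∀ x → Kmap τ φ μ' x ≡ ν x)

  -- K(τ,1_Y) is an isomorphism of complete L-lattices Kφ_{X',Y} ≅ Kφ:
  -- it lands in Kφ, is bijective (elements compared pointwise), and preserves the L-order.
  KmapIsomorphism : {X X' Y : Set ℓ} → (X' → X) → (X → Y → Carrier) → Set (c ⊔ ℓ)
  KmapIsomorphism {X' = X'} τ φ =
    (∀ μ' → InK (restrict τ φ) μ' → InK φ (Kmap τ φ μ'))
    × KmapSurjective τ φ
    × (∀ μ' μ'' → InK (restrict τ φ) μ' → InK (restrict τ φ) μ'' →
         (∀ x → Kmap τ φ μ' x ≡ Kmap τ φ μ'' x) → ∀ x' → μ' x' ≡ μ'' x')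
    × (∀ μ' μ'' → InK (restrict τ φ) μ' → InK (restrict τ φ) μ'' →
         subsethood μ' μ'' ≡ subsethood (Kmap τ φ μ') (Kmap τ φ μ''))

{-# OPTIONS --safe #-}
-- φ^∃ ⊣ φ^∀ is a Galois connection, so φ^∃φ^∀φ^∃ = φ^∃ and φ^∀φ^∃φ^∀ = φ^∀, and neither map
-- decreases L-subsethood. For φ' = φ_{X',Y} one has φ'^∀ λ = (φ^∀ λ) ∘ τ by definition and
-- φ'^∃ μ' = φ^∃ (extension of μ'). If φ^∃ μ = φ'^∃ μ', then μ' ≤ φ'^∀ φ^∃ μ = (φ^∀ φ^∃ μ) ∘ τ,
-- which gives (i) ⇒ (ii); (ii) ⇔ (iii) are rewritings with the closure identities. On Kφ',
-- ν ↦ ν ∘ τ is a left inverse of K(τ,1_Y), so K(τ,1_Y) is an L-order embedding, and ν ∈ Kφ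
-- lies in its image iff it is the image of ν ∘ τ, which is (iii) at λ = φ^∃ ν.
module Submission where

open import Defs
open import Level using (Level; _⊔_)
open import Data.Product using (Σ; _×_; _,_; proj₁; proj₂)
open import Function.Base using (_∘_)
open import Function.Bundles using (_⇔_; mk⇔; Equivalence)
open import Function.Definitions using (Injective)
open import Relation.Binary.Bundles using (Poset)
open import Relation.Binary.PropositionalEquality using (_≡_; _≗_; refl; sym; trans; cong₂)
open import Relation.Binary.Structures using (IsPartialOrder)
import Relation.Binary.Reasoning.PartialOrder as PosetReasoning

module Properties {c ℓ : Level} (L : CompleteResiduatedLattice c ℓ) where
  open CompleteResiduatedLattice L
  open Context L
  open IsPartialOrder isPartialOrder using (antisym; reflexive)
    renaming (refl to ≤-refl; trans to ≤-trans)

  poset : Poset c c c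
  poset = record { isPartialOrder = isPartialOrder }

  open PosetReasoning poset

  ⇒-intro : ∀ {a b d} → a * b ≤ d → a ≤ b ⇒ d
  ⇒-intro {a} {b} {d} = Equivalence.to (residuated a b d)

  ⇒-elim : ∀ {a b d} → a ≤ b ⇒ d → a * b ≤ d
  ⇒-elim {a} {b} {d} = Equivalence.from (residuated a b d)

  *-monoˡ-≤ : ∀ {a b} d → a ≤ b → a * d ≤ b * d
  *-monoˡ-≤ d a≤b = ⇒-elim (≤-trans a≤b (⇒-intro ≤-refl))

  *-monoʳ-≤ : ∀ d {a b} → a ≤ b → d * a ≤ d * b
  *-monoʳ-≤ d {a} {b} a≤b = begin
    d * a ≡⟨ *-comm d a ⟩
    a * d ≤⟨ *-monoˡ-≤ d a≤b ⟩
    b * d ≡⟨ *-comm b d ⟩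
    d * b ∎

  ⋁-cong : ∀ {I : Set ℓ} {f g : I → Carrier} → f ≗ g → ⋁ f ≡ ⋁ g
  ⋁-cong {f = f} {g} f≗g = antisym
    (⋁-least f _ (λ i → ≤-trans (reflexive (f≗g i)) (⋁-upper g i)))
    (⋁-least g _ (λ i → ≤-trans (reflexive (sym (f≗g i))) (⋁-upper f i)))

  *-distribʳ-⋁ : ∀ a {I : Set ℓ} (f : I → Carrier) → ⋁ f * a ≡ ⋁ (λ i → f i * a)
  *-distribʳ-⋁ a f = begin-equality
    ⋁ f * a            ≡⟨ *-comm (⋁ f) a ⟩
    a * ⋁ f            ≡⟨ *-distrib-⋁ a f ⟩
    ⋁ (λ i → a * f i)  ≡⟨ ⋁-cong (λ i → *-comm a (f i)) ⟩
    ⋁ (λ i → f i * a)  ∎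

  infix 4 _≤̇_

  _≤̇_ : {A : Set ℓ} → (A → Carrier) → (A → Carrier) → Set (c ⊔ ℓ)
  μ ≤̇ ν = ∀ a → μ a ≤ ν a

  ≗⇒≤̇ : {A : Set ℓ} {μ ν : A → Carrier} → μ ≗ ν → μ ≤̇ ν
  ≗⇒≤̇ μ≗ν a = reflexive (μ≗ν a)

  ≤̇-antisym : {A : Set ℓ} {μ ν : A → Carrier} → μ ≤̇ ν → ν ≤̇ μ → μ ≗ ν
  ≤̇-antisym μ≤̇ν ν≤̇μ a = antisym (μ≤̇ν a) (ν≤̇μ a)

  subsethood-greatest : {A : Set ℓ} {μ ν : A → Carrier} (s : Carrier) →
                        (∀ a → s * μ a ≤ ν a) → s ≤ subsethood μ ν
  subsethood-greatest s s*μ≤ν = ⋀-greatest _ s (λ a → ⇒-intro (s*μ≤ν a))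

  subsethood-elim : {A : Set ℓ} (μ ν : A → Carrier) (a : A) → subsethood μ ν * μ a ≤ ν a
  subsethood-elim μ ν a = ⇒-elim (⋀-lower (λ a → μ a ⇒ ν a) a)

  subsethood-cong : {A : Set ℓ} {μ₁ μ₂ ν₁ ν₂ : A → Carrier} →
                    μ₁ ≗ μ₂ → ν₁ ≗ ν₂ → subsethood μ₁ ν₁ ≡ subsethood μ₂ ν₂
  subsethood-cong μ₁≗μ₂ ν₁≗ν₂ = antisym
    (⋀-greatest _ _ (λ a → ≤-trans (⋀-lower _ a) (reflexive (cong₂ _⇒_ (μ₁≗μ₂ a) (ν₁≗ν₂ a)))))
    (⋀-greatest _ _ (λ a → ≤-trans (⋀-lower _ a)
      (reflexive (cong₂ _⇒_ (sym (μ₁≗μ₂ a)) (sym (ν₁≗ν₂ a))))))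

  subsethood-∘ : {A B : Set ℓ} (τ : B → A) (μ ν : A → Carrier) →
                 subsethood μ ν ≤ subsethood (μ ∘ τ) (ν ∘ τ)
  subsethood-∘ τ μ ν = ⋀-greatest _ _ (λ b → ⋀-lower _ (τ b))

  module _ {X Y : Set ℓ} (φ : X → Y → Carrier) where

    up∃-≤̇⇒≤̇-down∀ : ∀ {μ λ'} → up∃ φ μ ≤̇ λ' → μ ≤̇ down∀ φ λ'
    up∃-≤̇⇒≤̇-down∀ {μ} φ∃μ≤̇λ' x =
      ⋀-greatest _ _ (λ y → ⇒-intro (≤-trans (⋁-upper (λ x → μ x * φ x y) x) (φ∃μ≤̇λ' y)))

    ≤̇-down∀⇒up∃-≤̇ : ∀ {μ λ'} → μ ≤̇ down∀ φ λ' → up∃ φ μ ≤̇ λ'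
    ≤̇-down∀⇒up∃-≤̇ μ≤̇φ∀λ' y =
      ⋁-least _ _ (λ x → ⇒-elim (≤-trans (μ≤̇φ∀λ' x) (⋀-lower _ y)))

    ≤̇-down∀-up∃ : ∀ μ → μ ≤̇ down∀ φ (up∃ φ μ)
    ≤̇-down∀-up∃ μ = up∃-≤̇⇒≤̇-down∀ (λ _ → ≤-refl)

    up∃-down∀-≤̇ : ∀ λ' → up∃ φ (down∀ φ λ') ≤̇ λ'
    up∃-down∀-≤̇ λ' = ≤̇-down∀⇒up∃-≤̇ (λ _ → ≤-refl)

    up∃-mono : ∀ {μ ν} → μ ≤̇ ν → up∃ φ μ ≤̇ up∃ φ ν
    up∃-mono {ν = ν} μ≤̇ν = ≤̇-down∀⇒up∃-≤̇ (λ x → ≤-trans (μ≤̇ν x) (≤̇-down∀-up∃ ν x))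

    down∀-mono : ∀ {λ₁ λ₂} → λ₁ ≤̇ λ₂ → down∀ φ λ₁ ≤̇ down∀ φ λ₂
    down∀-mono {λ₁} λ₁≤̇λ₂ = up∃-≤̇⇒≤̇-down∀ (λ y → ≤-trans (up∃-down∀-≤̇ λ₁ y) (λ₁≤̇λ₂ y))

    up∃-cong : ∀ {μ ν} → μ ≗ ν → up∃ φ μ ≗ up∃ φ ν
    up∃-cong μ≗ν = ≤̇-antisym (up∃-mono (≗⇒≤̇ μ≗ν)) (up∃-mono (≗⇒≤̇ (sym ∘ μ≗ν)))

    down∀-cong : ∀ {λ₁ λ₂} → λ₁ ≗ λ₂ → down∀ φ λ₁ ≗ down∀ φ λ₂
    down∀-cong λ₁≗λ₂ = ≤̇-antisym (down∀-mono (≗⇒≤̇ λ₁≗λ₂)) (down∀-mono (≗⇒≤̇ (sym ∘ λ₁≗λ₂)))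

    up∃-down∀-up∃ : ∀ μ → up∃ φ (down∀ φ (up∃ φ μ)) ≗ up∃ φ μ
    up∃-down∀-up∃ μ = ≤̇-antisym (up∃-down∀-≤̇ (up∃ φ μ)) (up∃-mono (≤̇-down∀-up∃ μ))

    down∀-InK : ∀ λ' → InK φ (down∀ φ λ')
    down∀-InK λ' = ≤̇-antisym (down∀-mono (up∃-down∀-≤̇ λ')) (≤̇-down∀-up∃ (down∀ φ λ'))

    InK-cong : ∀ {μ ν} → μ ≗ ν → InK φ μ → InK φ ν
    InK-cong {μ} {ν} μ≗ν μ∈K x = begin-equality
      down∀ φ (up∃ φ ν) x ≡⟨ down∀-cong (up∃-cong (sym ∘ μ≗ν)) x ⟩
      down∀ φ (up∃ φ μ) x ≡⟨ μ∈K x ⟩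
      μ x                 ≡⟨ μ≗ν x ⟩
      ν x                 ∎

    subsethood-up∃ : ∀ μ ν → subsethood μ ν ≤ subsethood (up∃ φ μ) (up∃ φ ν)
    subsethood-up∃ μ ν = subsethood-greatest s (λ y → begin
      s * up∃ φ μ y                  ≡⟨ *-distrib-⋁ s _ ⟩
      ⋁ (λ x → s * (μ x * φ x y))    ≤⟨ ⋁-least _ _ (λ x → begin
        s * (μ x * φ x y)              ≡⟨ sym (*-assoc s (μ x) (φ x y)) ⟩
        (s * μ x) * φ x y              ≤⟨ *-monoˡ-≤ (φ x y) (subsethood-elim μ ν x) ⟩
        ν x * φ x y                    ≤⟨ ⋁-upper (λ x → ν x * φ x y) x ⟩
        up∃ φ ν y                      ∎) ⟩
      up∃ φ ν y                      ∎)
      where s = subsethood μ ν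

    subsethood-down∀ : ∀ λ₁ λ₂ → subsethood λ₁ λ₂ ≤ subsethood (down∀ φ λ₁) (down∀ φ λ₂)
    subsethood-down∀ λ₁ λ₂ = subsethood-greatest s (λ x →
      ⋀-greatest _ _ (λ y → ⇒-intro (begin
        (s * down∀ φ λ₁ x) * φ x y     ≡⟨ *-assoc s _ (φ x y) ⟩
        s * (down∀ φ λ₁ x * φ x y)     ≤⟨ *-monoʳ-≤ s (⇒-elim (⋀-lower _ y)) ⟩
        s * λ₁ y                       ≤⟨ subsethood-elim λ₁ λ₂ y ⟩
        λ₂ y                           ∎)))
      where s = subsethood λ₁ λ₂

  module _ {X Y X' : Set ℓ} (φ : X → Y → Carrier) (τ : X' → X) where

    private
      φ' : X' → Y → Carrier
      φ' = restrict τ φ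

    up∃-restrict-≤̇ : ∀ ν → up∃ φ' (ν ∘ τ) ≤̇ up∃ φ ν
    up∃-restrict-≤̇ ν y = ⋁-least _ _ (λ x' → ⋁-upper (λ x → ν x * φ x y) (τ x'))

    up∃-extend : ∀ μ' → up∃ φ (extend τ μ') ≗ up∃ φ' μ'
    up∃-extend μ' y = antisym
      (⋁-least _ _ (λ x → begin
        extend τ μ' x * φ x y           ≡⟨ *-distribʳ-⋁ (φ x y) _ ⟩
        ⋁ (λ p → μ' (proj₁ p) * φ x y)  ≤⟨ ⋁-least _ _ fibre-≤ ⟩
        up∃ φ' μ' y                     ∎))
      (⋁-least _ _ (λ x' → ≤-trans
        (*-monoˡ-≤ (φ (τ x') y) (⋁-upper (λ p → μ' (proj₁ p)) (x' , refl)))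
        (⋁-upper (λ x → extend τ μ' x * φ x y) (τ x'))))
      where
      fibre-≤ : ∀ {x} (p : Σ X' (λ x' → τ x' ≡ x)) → μ' (proj₁ p) * φ x y ≤ up∃ φ' μ' y
      fibre-≤ (x' , refl) = ⋁-upper (λ x' → μ' x' * φ' x' y) x'

    Kmap≗down∀-up∃-restrict : ∀ μ' → Kmap τ φ μ' ≗ down∀ φ (up∃ φ' μ')
    Kmap≗down∀-up∃-restrict μ' = down∀-cong φ (up∃-extend μ')

    up∃-Kmap : ∀ μ' → up∃ φ (Kmap τ φ μ') ≗ up∃ φ' μ'
    up∃-Kmap μ' y = trans (up∃-down∀-up∃ φ (extend τ μ') y) (up∃-extend μ' y)

    Kmap-InK : ∀ μ' → InK φ (Kmap τ φ μ')
    Kmap-InK μ' = down∀-InK φ (up∃ φ (extend τ μ'))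

    Kmap-∘-τ : ∀ {μ'} → InK φ' μ' → Kmap τ φ μ' ∘ τ ≗ μ'
    Kmap-∘-τ {μ'} μ'∈K x' = trans (Kmap≗down∀-up∃-restrict μ' (τ x')) (μ'∈K x')

    Kmap-injective : ∀ {μ' μ''} → InK φ' μ' → InK φ' μ'' →
                     Kmap τ φ μ' ≗ Kmap τ φ μ'' → μ' ≗ μ''
    Kmap-injective μ'∈K μ''∈K Kmap≗ x' =
      trans (sym (Kmap-∘-τ μ'∈K x')) (trans (Kmap≗ (τ x')) (Kmap-∘-τ μ''∈K x'))

    subsethood-Kmap : ∀ {μ' μ''} → InK φ' μ' → InK φ' μ'' →
                      subsethood μ' μ'' ≡ subsethood (Kmap τ φ μ') (Kmap τ φ μ'')
    subsethood-Kmap {μ'} {μ''} μ'∈K μ''∈K = antisym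
      (begin
        subsethood μ' μ''                                      ≤⟨ subsethood-up∃ φ' μ' μ'' ⟩
        subsethood (up∃ φ' μ') (up∃ φ' μ'')                    ≤⟨ subsethood-down∀ φ _ _ ⟩
        subsethood (down∀ φ (up∃ φ' μ')) (down∀ φ (up∃ φ' μ'')) ≡⟨ subsethood-cong
                                                                     (sym ∘ Kmap≗down∀-up∃-restrict μ')
                                                                     (sym ∘ Kmap≗down∀-up∃-restrict μ'') ⟩
        subsethood (Kmap τ φ μ') (Kmap τ φ μ'')                ∎)
      (begin
        subsethood (Kmap τ φ μ') (Kmap τ φ μ'')                ≤⟨ subsethood-∘ τ _ _ ⟩
        subsethood (Kmap τ φ μ' ∘ τ) (Kmap τ φ μ'' ∘ τ)        ≡⟨ subsethood-cong
                                                                     (Kmap-∘-τ μ'∈K) (Kmap-∘-τ μ''∈K) ⟩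
        subsethood μ' μ''                                      ∎)

    ReducibleByClosure : Set (c ⊔ ℓ)
    ReducibleByClosure = ∀ μ → up∃ φ μ ≗ up∃ φ' (down∀ φ (up∃ φ μ) ∘ τ)

    KernelsAgree : Set (c ⊔ ℓ)
    KernelsAgree = ∀ λ' → up∃ φ (down∀ φ λ') ≗ up∃ φ' (down∀ φ' λ')

    up∃-restrict-closure : ∀ μ μ' → up∃ φ μ ≗ up∃ φ' μ' →
                           up∃ φ μ ≗ up∃ φ' (down∀ φ (up∃ φ μ) ∘ τ)
    up∃-restrict-closure μ μ' φ∃μ≗φ'∃μ' = ≤̇-antisym
      (λ y → begin
        up∃ φ μ y                        ≡⟨ φ∃μ≗φ'∃μ' y ⟩
        up∃ φ' μ' y                      ≤⟨ up∃-mono φ' μ'≤̇closure y ⟩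
        up∃ φ' (down∀ φ (up∃ φ μ) ∘ τ) y ∎)
      (λ y → ≤-trans (up∃-restrict-≤̇ (down∀ φ (up∃ φ μ)) y) (reflexive (up∃-down∀-up∃ φ μ y)))
      where
      μ'≤̇closure : μ' ≤̇ down∀ φ' (up∃ φ μ)
      μ'≤̇closure = up∃-≤̇⇒≤̇-down∀ φ' (≗⇒≤̇ (sym ∘ φ∃μ≗φ'∃μ'))

    Reducible⇒ReducibleByClosure : Reducible τ φ → ReducibleByClosure
    Reducible⇒ReducibleByClosure reducible μ =
      up∃-restrict-closure μ (proj₁ (reducible μ)) (proj₂ (reducible μ))

    ReducibleByClosure⇒Reducible : ReducibleByClosure → Reducible τ φ
    ReducibleByClosure⇒Reducible byClosure μ = _ , byClosure μ

    ReducibleByClosure⇒KernelsAgree : ReducibleByClosure → KernelsAgree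
    ReducibleByClosure⇒KernelsAgree byClosure λ' y =
      trans (byClosure (down∀ φ λ') y) (up∃-cong φ' (down∀-InK φ λ' ∘ τ) y)

    KernelsAgree⇒ReducibleByClosure : KernelsAgree → ReducibleByClosure
    KernelsAgree⇒ReducibleByClosure agree μ y =
      trans (sym (up∃-down∀-up∃ φ μ y)) (agree (up∃ φ μ) y)

    KernelsAgree⇒KmapSurjective : KernelsAgree → KmapSurjective τ φ
    KernelsAgree⇒KmapSurjective agree ν ν∈K = ν ∘ τ , ν∘τ∈K , Kmap≗ν
      where
      closure≗ν∘τ : down∀ φ' (up∃ φ ν) ≗ ν ∘ τ
      closure≗ν∘τ x' = ν∈K (τ x')

      ν∘τ∈K : InK φ' (ν ∘ τ)
      ν∘τ∈K = InK-cong φ' closure≗ν∘τ (down∀-InK φ' (up∃ φ ν))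

      Kmap≗ν : Kmap τ φ (ν ∘ τ) ≗ ν
      Kmap≗ν x = begin-equality
        Kmap τ φ (ν ∘ τ) x                      ≡⟨ Kmap≗down∀-up∃-restrict (ν ∘ τ) x ⟩
        down∀ φ (up∃ φ' (ν ∘ τ)) x              ≡⟨ down∀-cong φ (up∃-cong φ' (sym ∘ closure≗ν∘τ)) x ⟩
        down∀ φ (up∃ φ' (down∀ φ' (up∃ φ ν))) x ≡⟨ down∀-cong φ (sym ∘ agree (up∃ φ ν)) x ⟩
        down∀ φ (up∃ φ (down∀ φ (up∃ φ ν))) x   ≡⟨ down∀-InK φ (up∃ φ ν) x ⟩
        down∀ φ (up∃ φ ν) x                     ≡⟨ ν∈K x ⟩
        ν x                                     ∎

    KmapSurjective⇒KernelsAgree : KmapSurjective τ φ → KernelsAgree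
    KmapSurjective⇒KernelsAgree surjective λ' y
      with surjective (down∀ φ λ') (down∀-InK φ λ')
    ... | μ' , μ'∈K , Kmap≗ = begin-equality
      up∃ φ (down∀ φ λ') y   ≡⟨ up∃-cong φ (sym ∘ Kmap≗) y ⟩
      up∃ φ (Kmap τ φ μ') y  ≡⟨ up∃-Kmap μ' y ⟩
      up∃ φ' μ' y            ≡⟨ up∃-cong φ' μ'≗ y ⟩
      up∃ φ' (down∀ φ' λ') y ∎
      where
      μ'≗ : μ' ≗ down∀ φ' λ'
      μ'≗ x' = trans (sym (Kmap-∘-τ μ'∈K x')) (Kmap≗ (τ x'))

    KmapSurjective⇒KmapIsomorphism : KmapSurjective τ φ → KmapIsomorphism τ φ
    KmapSurjective⇒KmapIsomorphism surjective =
      (λ μ' _ → Kmap-InK μ') , surjective , (λ _ _ → Kmap-injective) , (λ _ _ → subsethood-Kmap)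

proposition4p7 : ∀ {c ℓ : Level} (L : CompleteResiduatedLattice c ℓ)
    {X Y X' : Set ℓ} (φ : X → Y → CompleteResiduatedLattice.Carrier L)
    (τ : X' → X) → Injective _≡_ _≡_ τ →
    let open Context L in
    (Reducible τ φ
      ⇔ (∀ μ y → up∃ φ μ y ≡ up∃ (restrict τ φ) (λ x' → down∀ φ (up∃ φ μ) (τ x')) y))
    × ((∀ μ y → up∃ φ μ y ≡ up∃ (restrict τ φ) (λ x' → down∀ φ (up∃ φ μ) (τ x')) y)
      ⇔ (∀ λ' y → up∃ φ (down∀ φ λ') y ≡ up∃ (restrict τ φ) (down∀ (restrict τ φ) λ') y))
    × ((∀ λ' y → up∃ φ (down∀ φ λ') y ≡ up∃ (restrict τ φ) (down∀ (restrict τ φ) λ') y)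
      ⇔ KmapSurjective τ φ)
    × (KmapSurjective τ φ → KmapIsomorphism τ φ)
proposition4p7 L φ τ _ =
  mk⇔ (Reducible⇒ReducibleByClosure φ τ) (ReducibleByClosure⇒Reducible φ τ) ,
  mk⇔ (ReducibleByClosure⇒KernelsAgree φ τ) (KernelsAgree⇒ReducibleByClosure φ τ) ,
  mk⇔ (KernelsAgree⇒KmapSurjective φ τ) (KmapSurjective⇒KernelsAgree φ τ) ,
  KmapSurjective⇒KmapIsomorphism φ τ
  where open Properties L
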